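{- Let $s$ be a non-empty string and let $s'$ be obtained from $s$ by deleting its last character or its first character. If $P$ is a palindrome with $|P|>2$ that is a substring of $s$ but not a substring of $s'$ (i.e., its node is deleted from the eertree when passing from $s$ to $s'$), then $s'$ has a palindromic substring of length $|P|-2$.
   Context: A palindrome is a string equal to its reverse. -}

module Defs where

open import Data.List using (List; _∷_; []; _++_; reverse; length)
open import Data.Product using (∃-syntax; _×_)
open import Data.Sum using (_⊎_)
open import Relation.Binary.PropositionalEquality using (_≡_)

Palindrome : ∀ {a} {A : Set a} → List A → Set a
Palindrome w = reverse w ≡ w

Substring : ∀ {a} {A : Set a} → List A → List A → Set a
Substring w s = ∃[ u ] ∃[ v ] (u ++ w ++ v ≡ s)

DeleteEnd : ∀ {a} {A : Set a} → List A → List A → Set a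
DeleteEnd s s' = (∃[ c ] (s ≡ s' ++ c ∷ [])) ⊎ (∃[ c ] (s ≡ c ∷ s'))

{-# OPTIONS --safe #-}
module Submission where

-- Stripping the two end characters of P leaves a palindrome Q. Deleting an end
-- character of s destroys at most one end character of a given occurrence of P,
-- so the occurrence of Q inside it survives in s'.

open import Defs
open import Data.List using (List; []; _∷_; _++_; _∷ʳ_; reverse; length; initLast; _∷ʳ′_)
open import Data.List.Properties
  using (++-assoc; ∷-injectiveʳ; ∷ʳ-injectiveˡ; reverse-++; reverse-involutive; unfold-reverse; length-++)
open import Data.Nat using (_<_; _∸_; s≤s)
open import Data.Nat.Properties using (+-comm)
open import Data.Product using (∃-syntax; _×_; _,_)
open import Data.Sum using (inj₁; inj₂)
open import Relation.Binary.PropositionalEquality using (_≡_; refl; sym; trans; cong; subst; subst₂; module ≡-Reasoning)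
open import Relation.Nullary using (¬_)

module _ {a} {A : Set a} where

  Substring-++ˡ : (w v s : List A) → Substring (w ++ v) s → Substring w s
  Substring-++ˡ w v s (u , t , eq) = u , v ++ t ,
    subst (λ r → u ++ r ≡ s) (++-assoc w v t) eq

  Substring-++ʳ : (u w s : List A) → Substring (u ++ w) s → Substring w s
  Substring-++ʳ u w s (t , v , eq) = t ++ u , v , (begin
    (t ++ u) ++ w ++ v   ≡⟨ ++-assoc t u (w ++ v) ⟩
    t ++ u ++ w ++ v     ≡⟨ cong (t ++_) (sym (++-assoc u w v)) ⟩
    t ++ (u ++ w) ++ v   ≡⟨ eq ⟩
    s                    ∎)
    where open ≡-Reasoning

  Substring-reverse : (w s : List A) → Substring w s → Substring (reverse w) (reverse s)
  Substring-reverse w s (u , v , eq) = reverse v , reverse u , (begin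
    reverse v ++ reverse w ++ reverse u     ≡⟨ sym (++-assoc (reverse v) (reverse w) (reverse u)) ⟩
    (reverse v ++ reverse w) ++ reverse u   ≡⟨ cong (_++ reverse u) (sym (reverse-++ w v)) ⟩
    reverse (w ++ v) ++ reverse u           ≡⟨ sym (reverse-++ u (w ++ v)) ⟩
    reverse (u ++ w ++ v)                   ≡⟨ cong reverse eq ⟩
    reverse s                               ∎)
    where open ≡-Reasoning

  Substring-tail : (x c : A) (w s : List A) → Substring (x ∷ w) (c ∷ s) → Substring w s
  Substring-tail x c w s ([]    , v , eq) = [] , v , ∷-injectiveʳ eq
  Substring-tail x c w s (_ ∷ u , v , eq) = Substring-++ʳ (x ∷ []) w s
    (u , v , ∷-injectiveʳ eq)

  Substring-init : (x c : A) (w s : List A) → Substring (w ∷ʳ x) (s ∷ʳ c) → Substring w s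
  Substring-init x c w s sub = subst₂ Substring (reverse-involutive w) (reverse-involutive s)
    (Substring-reverse (reverse w) (reverse s)
      (Substring-tail x c (reverse w) (reverse s)
        (subst₂ Substring (reverse-++ w (x ∷ [])) (reverse-++ s (c ∷ []))
          (Substring-reverse (w ∷ʳ x) (s ∷ʳ c) sub))))

  Substring-inner : (x y : A) (w s s' : List A) →
    DeleteEnd s s' → Substring (x ∷ w ∷ʳ y) s → Substring w s'
  Substring-inner x y w s s' (inj₁ (c , refl)) sub =
    Substring-++ʳ (x ∷ []) w s' (Substring-init y c (x ∷ w) s' sub)
  Substring-inner x y w s s' (inj₂ (c , refl)) sub =
    Substring-++ˡ w (y ∷ []) s' (Substring-tail x c (w ∷ʳ y) s' sub)

  Palindrome-inner : (x y : A) (w : List A) → Palindrome (x ∷ w ∷ʳ y) → Palindrome w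
  Palindrome-inner x y w pal = ∷ʳ-injectiveˡ (reverse w) w (∷-injectiveʳ (begin
    y ∷ reverse w ∷ʳ x          ≡⟨ cong (_∷ʳ x) (sym (reverse-++ w (y ∷ []))) ⟩
    reverse (w ∷ʳ y) ∷ʳ x       ≡⟨ sym (unfold-reverse x (w ∷ʳ y)) ⟩
    reverse (x ∷ w ∷ʳ y)        ≡⟨ pal ⟩
    x ∷ w ∷ʳ y                  ∎))
    where open ≡-Reasoning

  length-inner : (x y : A) (w : List A) → length w ≡ length (x ∷ w ∷ʳ y) ∸ 2
  length-inner x y w = sym (cong (_∸ 1) (trans (length-++ w) (+-comm (length w) 1)))

proposition5 : ∀ {a} {A : Set a} (s s' P : List A) →
    0 < length s →
    DeleteEnd s s' →
    Palindrome P →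
    2 < length P →
    Substring P s →
    ¬ Substring P s' →
    ∃[ Q ] (Palindrome Q × Substring Q s' × length Q ≡ length P ∸ 2)
proposition5 s s' (x ∷ rest) _ del pal _ sub _ with initLast rest
... | w ∷ʳ′ y = w , Palindrome-inner x y w pal , Substring-inner x y w s s' del sub , length-inner x y w
proposition5 s s' (x ∷ .[]) _ _ _ (s≤s ()) _ _ | []
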